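{- Let $R(\mathbf{x},\mathbf{x}')$ be a difference bounds constraint, $R_b(\mathbf{x},\mathbf{x}')$ its balanced closure, and $\widehat{R}_b(\ell,\mathbf{x},\mathbf{x}')$ a closed form of $R_b$. Then the formula $$\bigvee_{i=1}^{2}\big(k=i\wedge R^i(\mathbf{x},\mathbf{x}')\big)\;\vee\;\exists\mathbf{x}_1,\mathbf{x}_2.\;k\ge3\wedge R(\mathbf{x},\mathbf{x}_1)\wedge\widehat{R}_b(\ell,\mathbf{x}_1,\mathbf{x}_2)[k-2/\ell]\wedge R(\mathbf{x}_2,\mathbf{x}')$$ is a closed form $\widehat{R}(k,\mathbf{x},\mathbf{x}')$ of $R$.
   Context: Variables range over $\mathbb{Z}$; $\mathbf{x}=\{x_1,\dots,x_N\}$, $\mathbf{x}'$, $\mathbf{x}_1$, $\mathbf{x}_2$ are copies. A difference bounds constraint is a finite conjunction of atoms $u-v\le c$, $c\in\mathbb{Z}$. The balanced closure of $R$ is $R_b := R\wedge\bigwedge_{(x_i-x_j\le c)\in\mathrm{atoms}(R)} x_i'-x_j'\le c\;\wedge\bigwedge_{(x_i'-x_j'\le c)\in\mathrm{atoms}(R)} x_i-x_j\le c$ (the indexing atoms being those of $R$ with both variables unprimed, resp. both primed). $R^n$ is the $n$-fold composition of $R$. A closed form of $R$ is a formula $\widehat{R}(k,\mathbf{x},\mathbf{x}')$ with $k$ fresh such that for all $n\ge1$, $\widehat{R}[n/k]$ defines $R^n$. -}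

module Defs where

open import Data.Nat using (ℕ; zero; suc)
open import Data.Fin using (Fin)
open import Data.Integer using (ℤ; +_; _-_; _≤_)
open import Data.Sum using (_⊎_; inj₁; inj₂)
open import Data.Product using (Σ; _×_)
open import Data.List using (List; []; _∷_; _++_; concatMap)
open import Data.List.Relation.Unary.All using (All)
open import Relation.Binary.PropositionalEquality using (_≡_)

Val : ℕ → Set
Val N = Fin N → ℤ

-- Variables of a relation R(x, x'): inj₁ i is x_i (unprimed), inj₂ i is x_i' (primed).
Var : ℕ → Set
Var N = Fin N ⊎ Fin N

record Atom (N : ℕ) : Set where
  constructor atom
  field
    u : Var N
    v : Var N
    c : ℤ

DBC : ℕ → Set
DBC N = List (Atom N)

env : ∀ {N} → Val N → Val N → Var N → ℤ
env x x' (inj₁ i) = x i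
env x x' (inj₂ i) = x' i

⟦_⟧ₐ : ∀ {N} → Atom N → Val N → Val N → Set
⟦ atom u v c ⟧ₐ x x' = env x x' u - env x x' v ≤ c

⟦_⟧ : ∀ {N} → DBC N → Val N → Val N → Set
⟦ R ⟧ x x' = All (λ a → ⟦ a ⟧ₐ x x') R

balanceAtom : ∀ {N} → Atom N → List (Atom N)
balanceAtom (atom (inj₁ i) (inj₁ j) c) = atom (inj₂ i) (inj₂ j) c ∷ []
balanceAtom (atom (inj₂ i) (inj₂ j) c) = atom (inj₁ i) (inj₁ j) c ∷ []
balanceAtom _ = []

balanced : ∀ {N} → DBC N → DBC N
balanced R = R ++ concatMap balanceAtom R

Pow : ∀ {N} → (Val N → Val N → Set) → ℕ → Val N → Val N → Set
Pow S zero x x' = x ≡ x'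
Pow S (suc n) x x' = Σ (Val _) (λ y → S x y × Pow S n y x')

-- A (semantic) formula with a fresh integer parameter k.
Param : ℕ → Set₁
Param N = ℤ → Val N → Val N → Set

ClosedForm : ∀ {N} → (Val N → Val N → Set) → Param N → Set
ClosedForm S P = ∀ (n : ℕ) (x x' : Val _) →
  (P (+ suc n) x x' → Pow S (suc n) x x') × (Pow S (suc n) x x' → P (+ suc n) x x')

hatR : ∀ {N} → DBC N → Param N → Param N
hatR R Rbhat k x x' =
  (k ≡ + 1 × Pow ⟦ R ⟧ 1 x x')
  ⊎ (k ≡ + 2 × Pow ⟦ R ⟧ 2 x x')
  ⊎ Σ (Val _) (λ x₁ → Σ (Val _) (λ x₂ →
       (+ 3 ≤ k) × ⟦ R ⟧ x x₁ × Rbhat (k - + 2) x₁ x₂ × ⟦ R ⟧ x₂ x'))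

module Submission where

-- For n = 1, 2 the formula hatR R Rbhat states R^n directly, so
-- only n ≥ 3 needs an argument: there we must show
--     R^(m+3)  =  R ∘ R_b^(m+1) ∘ R,
-- after which the closed form of R_b (at ℓ = k - 2 = m + 1) finishes the proof.
--   * R_b ⊆ R, because R_b is R conjoined with further atoms; hence R_b^n ⊆ R^n,
--     which gives "⊇" together with the snoc-decomposition of R-chains.
--   * If w R x R y R z then x R_b y: the unprimed balancing atoms of (x, y) are
--     unprimed atoms of R evaluated at y, guaranteed by y R z, and the primed
--     ones are primed atoms of R evaluated at x, guaranteed by w R x.  Hence
--     every inner step of an R-chain that has an R-step before and after it is
--     an R_b-step, which gives "⊆".

open import Defs
open import Data.Nat using (ℕ; zero; suc; z≤n; s≤s)
open import Data.Integer using (+_; +≤+; _≤_)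
open import Function using (_∘_)
open import Data.Sum using (inj₁; inj₂)
open import Data.Product using (Σ; _×_; _,_; proj₁; proj₂)
open import Data.List using (_∷_; concatMap)
open import Data.List.Relation.Unary.All using (All; []; _∷_)
open import Data.List.Relation.Unary.All.Properties using (++⁺; ++⁻ˡ)
open import Relation.Binary.PropositionalEquality using (refl)

Rel : ℕ → Set₁
Rel N = Val N → Val N → Set

_⊆_ : ∀ {N} → Rel N → Rel N → Set
S ⊆ T = ∀ {x y} → S x y → T x y

module _ {N : ℕ} where

  Pow-mono : {S T : Rel N} → S ⊆ T → (n : ℕ) → Pow S n ⊆ Pow T n
  Pow-mono S⊆T zero    eq            = eq
  Pow-mono S⊆T (suc n) (y , s , ss)  = y , S⊆T s , Pow-mono S⊆T n ss

  Pow-snoc : {S : Rel N} (n : ℕ) {a c b : Val N} → Pow S n a c → S c b → Pow S (suc n) a b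
  Pow-snoc zero    refl         s = _ , s , refl
  Pow-snoc (suc n) (y , t , ts) s = y , t , Pow-snoc n ts s

  Pow-unsnoc : {S : Rel N} (n : ℕ) {a b : Val N} →
    Pow S (suc n) a b → Σ (Val N) (λ c → Pow S n a c × S c b)
  Pow-unsnoc zero    (y , s , refl) = _ , refl , s
  Pow-unsnoc (suc n) (y , s , ss) with Pow-unsnoc n ss
  ... | c , ts , t = c , (y , s , ts) , t

  Sandwiched : Rel N → Rel N → Set
  Sandwiched S T = ∀ {w x y z} → S w x → S x y → S y z → T x y

  -- An S-chain with an S-step before it and an S-step after it is a T-chain.
  -- The step following each inner node is supplied by Pow-snoc.
  Pow-sandwich : {S T : Rel N} → Sandwiched S T → (n : ℕ) {w x y z : Val N} →
    S w x → Pow S n x y → S y z → Pow T n x y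
  Pow-sandwich sw zero    s eq           s' = eq
  Pow-sandwich sw (suc n) s (v , t , ts) s' with Pow-snoc n ts s'
  ... | u , t' , _ = v , sw s t t' , Pow-sandwich sw n t ts s'

  long-chain-split : {S T : Rel N} → Sandwiched S T → (n : ℕ) {a b : Val N} →
    Pow S (suc (suc n)) a b →
    Σ (Val N) (λ x₁ → Σ (Val N) (λ x₂ → S a x₁ × Pow T n x₁ x₂ × S x₂ b))
  long-chain-split sw n (x₁ , s , ss) with Pow-unsnoc n ss
  ... | x₂ , ts , s' = x₁ , x₂ , s , Pow-sandwich sw n s ts s' , s'

  long-chain-join : {S T : Rel N} → T ⊆ S → (n : ℕ) {a x₁ x₂ b : Val N} →
    S a x₁ → Pow T n x₁ x₂ → S x₂ b → Pow S (suc (suc n)) a b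
  long-chain-join T⊆S n s ts s' = _ , s , Pow-snoc n (Pow-mono T⊆S n ts) s'

  -- The balanced closure only adds atoms, so it defines a smaller relation.
  balanced-⊆ : (R : DBC N) → ⟦ balanced R ⟧ ⊆ ⟦ R ⟧
  balanced-⊆ R = ++⁻ˡ R

  balanceAtom-holds : (a : Atom N) {w x y z : Val N} →
    ⟦ a ⟧ₐ w x → ⟦ a ⟧ₐ y z → All (λ b → ⟦ b ⟧ₐ x y) (balanceAtom a)
  balanceAtom-holds (atom (inj₁ i) (inj₁ j) c) before after = after ∷ []
  balanceAtom-holds (atom (inj₂ i) (inj₂ j) c) before after = before ∷ []
  balanceAtom-holds (atom (inj₁ i) (inj₂ j) c) before after = []
  balanceAtom-holds (atom (inj₂ i) (inj₁ j) c) before after = []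

  balancing-holds : (R : DBC N) {w x y z : Val N} → ⟦ R ⟧ w x → ⟦ R ⟧ y z →
    All (λ b → ⟦ b ⟧ₐ x y) (concatMap balanceAtom R)
  balancing-holds (a ∷ R) (p ∷ ps) (q ∷ qs) =
    ++⁺ (balanceAtom-holds a p q) (balancing-holds R ps qs)
  balancing-holds _       []       []       = []

  balanced-sandwiched : (R : DBC N) → Sandwiched ⟦ R ⟧ ⟦ balanced R ⟧
  balanced-sandwiched R before middle after =
    ++⁺ middle (balancing-holds R before after)

proposition2 : (N : ℕ) (R : DBC N) (Rbhat : Param N) →
    ClosedForm ⟦ balanced R ⟧ Rbhat → ClosedForm ⟦ R ⟧ (hatR R Rbhat)
proposition2 N R Rbhat closed zero x x' = one , inj₁ ∘ (refl ,_)
  where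
  one : hatR R Rbhat (+ 1) x x' → Pow ⟦ R ⟧ 1 x x'
  one (inj₁ (_ , p))                            = p
  one (inj₂ (inj₁ (() , _)))
  one (inj₂ (inj₂ (_ , _ , +≤+ (s≤s ()) , _)))
proposition2 N R Rbhat closed (suc zero) x x' = two , inj₂ ∘ inj₁ ∘ (refl ,_)
  where
  two : hatR R Rbhat (+ 2) x x' → Pow ⟦ R ⟧ 2 x x'
  two (inj₁ (() , _))
  two (inj₂ (inj₁ (_ , p)))                            = p
  two (inj₂ (inj₂ (_ , _ , +≤+ (s≤s (s≤s ())) , _)))
-- For k = m + 3 we have k - 2 = m + 1 definitionally, so Rbhat (k - 2) is R_b^(m+1).
proposition2 N R Rbhat closed (suc (suc m)) x x' = long , split
  where
  k≥3 : + 3 ≤ + suc (suc (suc m))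
  k≥3 = +≤+ (s≤s (s≤s (s≤s z≤n)))

  long : hatR R Rbhat (+ suc (suc (suc m))) x x' → Pow ⟦ R ⟧ (suc (suc (suc m))) x x'
  long (inj₁ (() , _))
  long (inj₂ (inj₁ (() , _)))
  long (inj₂ (inj₂ (x₁ , x₂ , _ , s , h , s'))) =
    long-chain-join (balanced-⊆ R) (suc m) s (proj₁ (closed m x₁ x₂) h) s'

  split : Pow ⟦ R ⟧ (suc (suc (suc m))) x x' → hatR R Rbhat (+ suc (suc (suc m))) x x'
  split p with long-chain-split (balanced-sandwiched R) (suc m) p
  ... | x₁ , x₂ , s , ts , s' =
    inj₂ (inj₂ (x₁ , x₂ , k≥3 , s , proj₂ (closed m x₁ x₂) ts , s'))
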